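{- Let $\mathbf A=(A,\le,0,1)$ be a bounded MLUB-complete poset, $(T,R)$ a time frame with $R$ serial, $P,F,H,G$ the tense operators induced by $(T,R)$, and $\widehat G,\widehat P,\widehat H,\widehat F$ the operators on $\operatorname{DM}(\mathbf A)^T$ constructed by means of $(T,R)$. Then for all $C,D\in\mathcal P_+(A^T)$: (i) $\operatorname{Max}\widehat G(LU(C))=G(U(C))=G(\operatorname{Min}U(C))$; (ii) $\widehat P(L(D))=L(P(L(D)))=L(P(\operatorname{Max}L(D)))$; (iii) $\operatorname{Max}\widehat H(LU(C))=H(U(C))=H(\operatorname{Min}U(C))$; (iv) $\widehat F(L(D))=L(F(L(D)))=L(F(\operatorname{Max}L(D)))$.
   Context: For a poset $(A,\le)$ and $X\subseteq A$: $L(X)=\{a\mid a\le x\ \forall x\in X\}$, $U(X)=\{a\mid x\le a\ \forall x\in X\}$, $LU(X)=L(U(X))$; $\operatorname{Max}X,\operatorname{Min}X$ are the sets of maximal/minimal elements. MLUB-complete: for every nonempty $M\subseteq A$, every upper bound of $M$ lies above some minimal upper bound of $M$ and every lower bound lies below some maximal lower bound. $\mathcal P_+(X)$ = nonempty subsets of $X$. A time frame is $(T,R)$, $T\neq\emptyset$, $R\subseteq T\times T$; serial: each $s$ has some $r$ with $rRs$ and some $t$ with $sRt$. $A^T$ carries the componentwise order, and $L,U,\operatorname{Max},\operatorname{Min}$ of subsets of $A^T$ refer to it. For $B\subseteq A^T$, $B(t)=\{q(t)\mid q\in B\}$. The tense operators induced by $(T,R)$ are $P,F,H,G:\mathcal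 P_+(A^T)\to(\mathcal P_+A)^T$: $P(B)(s)=\operatorname{Min}U(\{q(t)\mid q\in B, tRs\})$, $F(B)(s)=\operatorname{Min}U(\{q(t)\mid q\in B, sRt\})$, $H(B)(s)=\operatorname{Max}L(\{q(t)\mid q\in B, tRs\})$, $G(B)(s)=\operatorname{Max}L(\{q(t)\mid q\in B, sRt\})$. Dedekind–MacNeille completion: $\operatorname{DM}(\mathbf A)=\{X\subseteq A\mid LU(X)=X\}$ ordered by inclusion; it is a complete lattice with meets given by intersection and joins $\bigvee_i X_i=LU(\bigcup_i X_i)$. For $p\in\operatorname{DM}(\mathbf A)^T$ and $s\in T$: $\widehat G(p)(s)=\bigwedge\{p(t)\mid sRt\}$, $\widehat P(p)(s)=\bigvee\{p(t)\mid tRs\}$, $\widehat H(p)(s)=\bigwedge\{p(t)\mid tRs\}$, $\widehat F(p)(s)=\bigvee\{p(t)\mid sRt\}$. Identifications: a subset of $A^T$ of the form $\prod_{t\in T}Z_t$ is identified with the function $t\mapsto Z_t$ (in particular for $C\subseteq A^T$, $L(C)=\prod_t L(C(t))$ and $LU(C)=\prod_t LU(C(t))$ are regarded as elements of $\operatorname{DM}(\mathbf A)^T$); an element $Z\in(\mathcal P_+A)^T$ is identified with $\prod_t Z(t)\subseteq A^T$ when operators are applied to it; for a function $Z$ from $T$ to subsets of $A$, $\operatorname{Max}Z$ and $L(Z)$ are taken pointwise: $(\operatorname{Max}Z)(t)=\operatorname{Max}Z(t)$, $L(Z)(t)=L(Z(t))$. -}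

module Defs where

open import Level using (Level; _⊔_)
open import Data.Product using (Σ; ∃; ∃-syntax; _×_; _,_)
open import Relation.Unary using (Pred; _∈_; _≐_; Satisfiable)
open import Relation.Binary using (Rel; Poset)
open import Relation.Binary.PropositionalEquality using (_≡_)

module PosetOps {ℓ : Level} (Pos : Poset ℓ ℓ ℓ) where
  open Poset Pos renaming (Carrier to A)

  Lo : Pred A ℓ → Pred A ℓ
  Lo X a = ∀ x → x ∈ X → a ≤ x

  Up : Pred A ℓ → Pred A ℓ
  Up X a = ∀ x → x ∈ X → x ≤ a

  MaxS : Pred A ℓ → Pred A ℓ
  MaxS X a = a ∈ X × (∀ y → y ∈ X → a ≤ y → a ≈ y)

  MinS : Pred A ℓ → Pred A ℓ
  MinS X a = a ∈ X × (∀ y → y ∈ X → y ≤ a → a ≈ y)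

  Bounded : Set ℓ
  Bounded = (Σ A λ z → ∀ x → z ≤ x) × (Σ A λ o → ∀ x → x ≤ o)

  MLUBComplete : Set (Level.suc ℓ)
  MLUBComplete = (M : Pred A ℓ) → Satisfiable M →
      (∀ u → u ∈ Up M → ∃[ m ] (m ∈ MinS (Up M) × m ≤ u))
    × (∀ l → l ∈ Lo M → ∃[ m ] (m ∈ MaxS (Lo M) × l ≤ m))

Serial : {ℓ : Level} {T : Set ℓ} → Rel T ℓ → Set ℓ
Serial {T = T} R = ∀ s → (∃[ r ] R r s) × (∃[ t ] R s t)

module TenseOps {ℓ : Level} (Pos : Poset ℓ ℓ ℓ) (T : Set ℓ) (R : Rel T ℓ) where
  open Poset Pos renaming (Carrier to A)
  open PosetOps Pos public

  _≤T_ : (T → A) → (T → A) → Set ℓ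
  p ≤T q = ∀ t → p t ≤ q t

  _≈T_ : (T → A) → (T → A) → Set ℓ
  p ≈T q = ∀ t → p t ≈ q t

  LoT : Pred (T → A) ℓ → Pred (T → A) ℓ
  LoT X p = ∀ q → q ∈ X → p ≤T q

  UpT : Pred (T → A) ℓ → Pred (T → A) ℓ
  UpT X p = ∀ q → q ∈ X → q ≤T p

  MaxT : Pred (T → A) ℓ → Pred (T → A) ℓ
  MaxT X p = p ∈ X × (∀ q → q ∈ X → p ≤T q → p ≈T q)

  MinT : Pred (T → A) ℓ → Pred (T → A) ℓ
  MinT X p = p ∈ X × (∀ q → q ∈ X → q ≤T p → p ≈T q)

  at : Pred (T → A) ℓ → T → Pred A ℓ
  at B t a = ∃[ q ] (q ∈ B × q t ≡ a)

  past : Pred (T → A) ℓ → T → Pred A ℓ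
  past B s a = ∃[ t ] (R t s × a ∈ at B t)

  future : Pred (T → A) ℓ → T → Pred A ℓ
  future B s a = ∃[ t ] (R s t × a ∈ at B t)

  Pt Ft Ht Gt : Pred (T → A) ℓ → T → Pred A ℓ
  Pt B s = MinS (Up (past B s))
  Ft B s = MinS (Up (future B s))
  Ht B s = MaxS (Lo (past B s))
  Gt B s = MaxS (Lo (future B s))

  MaxP : (T → Pred A ℓ) → T → Pred A ℓ
  MaxP Z t = MaxS (Z t)

  LoP : (T → Pred A ℓ) → T → Pred A ℓ
  LoP Z t = Lo (Z t)

  -- Elements of DM(A)^T are represented as functions T → Pred A.
  -- L(C) and LU(C) for C ⊆ A^T, regarded as elements of DM(A)^T
  LoDM : Pred (T → A) ℓ → T → Pred A ℓ
  LoDM C t = Lo (at C t)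

  LUDM : Pred (T → A) ℓ → T → Pred A ℓ
  LUDM C t = Lo (Up (at C t))

  -- Operators on DM(A)^T: meets in DM(A) are intersections,
  -- joins are LU of unions.
  Ĝ Ĥ P̂ F̂ : (T → Pred A ℓ) → T → Pred A ℓ
  Ĝ p s a = ∀ t → R s t → a ∈ p t
  Ĥ p s a = ∀ t → R t s → a ∈ p t
  P̂ p s = Lo (Up (λ a → ∃[ t ] (R t s × a ∈ p t)))
  F̂ p s = Lo (Up (λ a → ∃[ t ] (R s t × a ∈ p t)))

  _≐T_ : (T → Pred A ℓ) → (T → Pred A ℓ) → Set ℓ
  X ≐T Y = ∀ s → X s ≐ Y s

{-# OPTIONS --safe #-}
module Submission where

-- All four identities reduce to two facts about the values at a single
-- instant t.  First, L({q(t) | q ∈ U(C)}) = LU(C(t)): every upper bound u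
-- of C(t) is, up to ≈, the value at t of some q ∈ U(C), namely a function
-- choosing at each t′ a minimal upper bound of C(t′) ∪ {u}.  Second,
-- Min U(C) is coinitial in U(C), because minimal upper bounds can be chosen
-- pointwise.  Since lower bounds of a union are the intersection of the
-- lower bounds, this gives (i); for (ii) one also needs LU(Y) = L(Min U(Y)),
-- which is MLUB-completeness.

open import Defs
open import Level using (Level)
open import Data.Product using (_×_; _,_; proj₁; proj₂; ∃-syntax; swap)
open import Data.Sum using (_⊎_; inj₁; inj₂)
open import Function using (_∘_; flip)
open import Relation.Unary using (Pred; Satisfiable; _∈_; _⊆_; _≐_)
open import Relation.Unary.Properties using (≐-sym; ≐-trans)
open import Relation.Binary using (Rel; Poset)
import Relation.Binary.Construct.Flip.EqAndOrd as Flip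
open import Relation.Binary.PropositionalEquality using (_≡_; refl)

module Bounds {ℓ : Level} (Pos : Poset ℓ ℓ ℓ) where
  open Poset Pos renaming (Carrier to A; trans to ≤-trans)
  open PosetOps Pos

  private
    variable
      X Y : Pred A ℓ

  Coinitial : Pred A ℓ → Pred A ℓ → Set ℓ
  Coinitial X Y = ∀ y → y ∈ Y → ∃[ x ] (x ∈ X × x ≤ y)

  Lo-antitone : X ⊆ Y → Lo Y ⊆ Lo X
  Lo-antitone X⊆Y a∈LY x x∈X = a∈LY x (X⊆Y x∈X)

  Lo-coinitial : Coinitial X Y → Lo X ⊆ Lo Y
  Lo-coinitial X≼Y a∈LX y y∈Y with X≼Y y y∈Y
  ... | x , x∈X , x≤y = ≤-trans (a∈LX x x∈X) x≤y

  Lo-cong : X ≐ Y → Lo X ≐ Lo Y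
  Lo-cong (X⊆Y , Y⊆X) = Lo-antitone Y⊆X , Lo-antitone X⊆Y

  Lo-≐-coinitial : X ⊆ Y → Coinitial X Y → Lo X ≐ Lo Y
  Lo-≐-coinitial X⊆Y X≼Y = Lo-coinitial X≼Y , Lo-antitone X⊆Y

  MaxS-cong : X ≐ Y → MaxS X ≐ MaxS Y
  MaxS-cong (X⊆Y , Y⊆X) =
      (λ (a∈X , a-max) → X⊆Y a∈X , λ y y∈Y → a-max y (Y⊆X y∈Y))
    , (λ (a∈Y , a-max) → Y⊆X a∈Y , λ y y∈X → a-max y (X⊆Y y∈X))

  MinS-cong : X ≐ Y → MinS X ≐ MinS Y
  MinS-cong (X⊆Y , Y⊆X) =
      (λ (a∈X , a-min) → X⊆Y a∈X , λ y y∈Y → a-min y (Y⊆X y∈Y))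
    , (λ (a∈Y , a-min) → Y⊆X a∈Y , λ y y∈X → a-min y (X⊆Y y∈X))

  module _ (mlub : MLUBComplete) where

    MinS-Up-coinitial : Satisfiable X → Coinitial (MinS (Up X)) (Up X)
    MinS-Up-coinitial X≠∅ = proj₁ (mlub _ X≠∅)

    Lo-MinS-Up : Satisfiable X → Lo (MinS (Up X)) ≐ Lo (Up X)
    Lo-MinS-Up X≠∅ = Lo-≐-coinitial proj₁ (MinS-Up-coinitial X≠∅)

module Pointwise {ℓ : Level} (Pos : Poset ℓ ℓ ℓ) (T : Set ℓ) (R : Rel T ℓ)
  (bounded : PosetOps.Bounded Pos) (mlub : PosetOps.MLUBComplete Pos) where
  open Poset Pos renaming (Carrier to A; refl to ≤-refl)
  open TenseOps Pos T R
  open Bounds Pos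

  private
    one : A
    one = proj₁ (proj₂ bounded)

    ≤-one : ∀ x → x ≤ one
    ≤-one = proj₂ (proj₂ bounded)

  UpT-at : ∀ {C q} → q ∈ UpT C → ∀ t → q t ∈ Up (at C t)
  UpT-at q∈UC t _ (c , c∈C , refl) = q∈UC c c∈C t

  -- The detour through C(t′) ∪ {u} avoids deciding whether t′ equals t:
  -- at t′ = t the minimal upper bound is forced to be u itself.
  UpT-at-coinitial : ∀ C t → Coinitial (at (UpT C) t) (Up (at C t))
  UpT-at-coinitial C t u u∈UCt = q t , (q , q∈UC , refl) , qt≤u
    where
    M : T → Pred A ℓ
    M t′ x = x ∈ at C t′ ⊎ x ≡ u

    minimal : ∀ t′ → ∃[ m ] (m ∈ MinS (Up (M t′)) × m ≤ one)
    minimal t′ = MinS-Up-coinitial mlub (u , inj₂ refl) one (λ x _ → ≤-one x)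

    q : T → A
    q t′ = proj₁ (minimal t′)

    q-upper : ∀ t′ → q t′ ∈ Up (M t′)
    q-upper t′ = proj₁ (proj₁ (proj₂ (minimal t′)))

    q∈UC : q ∈ UpT C
    q∈UC c c∈C t′ = q-upper t′ (c t′) (inj₁ (c , c∈C , refl))

    u∈UMt : u ∈ Up (M t)
    u∈UMt x (inj₁ x∈Ct) = u∈UCt x x∈Ct
    u∈UMt x (inj₂ refl) = ≤-refl

    qt≤u : q t ≤ u
    qt≤u = reflexive (proj₂ (proj₁ (proj₂ (minimal t))) u u∈UMt (q-upper t u (inj₂ refl)))

  MinT-UpT-coinitial : ∀ {C} → Satisfiable C →
    ∀ q → q ∈ UpT C → ∃[ m ] (m ∈ MinT (UpT C) × m ≤T q)
  MinT-UpT-coinitial {C} (c , c∈C) q q∈UC = m , (m∈UC , m-minimal) , m≤q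
    where
    minimal : ∀ t → ∃[ m ] (m ∈ MinS (Up (at C t)) × m ≤ q t)
    minimal t = MinS-Up-coinitial mlub (c t , c , c∈C , refl) (q t) (UpT-at q∈UC t)

    m : T → A
    m t = proj₁ (minimal t)

    m∈UC : m ∈ UpT C
    m∈UC c′ c′∈C t = proj₁ (proj₁ (proj₂ (minimal t))) (c′ t) (c′ , c′∈C , refl)

    m-minimal : ∀ q′ → q′ ∈ UpT C → q′ ≤T m → m ≈T q′
    m-minimal q′ q′∈UC q′≤m t =
      proj₂ (proj₁ (proj₂ (minimal t))) (q′ t) (UpT-at q′∈UC t) (q′≤m t)

    m≤q : m ≤T q
    m≤q t = proj₂ (proj₂ (minimal t))

  LoDM-UpT : ∀ C → LoDM (UpT C) ≐T LUDM C
  LoDM-UpT C t = Lo-≐-coinitial at-UpT⊆Up-at (UpT-at-coinitial C t)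
    where
    at-UpT⊆Up-at : at (UpT C) t ⊆ Up (at C t)
    at-UpT⊆Up-at (q , q∈UC , refl) = UpT-at q∈UC t

  LoDM-MinT-UpT : ∀ {C} → Satisfiable C → LoDM (MinT (UpT C)) ≐T LUDM C
  LoDM-MinT-UpT {C} C≠∅ t = ≐-trans (Lo-≐-coinitial at-MinT⊆at-UpT coinitial) (LoDM-UpT C t)
    where
    at-MinT⊆at-UpT : at (MinT (UpT C)) t ⊆ at (UpT C) t
    at-MinT⊆at-UpT (q , (q∈UC , _) , qt≡x) = q , q∈UC , qt≡x

    coinitial : Coinitial (at (MinT (UpT C)) t) (at (UpT C) t)
    coinitial _ (q , q∈UC , refl) with MinT-UpT-coinitial C≠∅ q q∈UC
    ... | m , m∈MinUC , m≤q = m t , (m , m∈MinUC , refl) , m≤q t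

module Tense {ℓ : Level} (Pos : Poset ℓ ℓ ℓ) (T : Set ℓ) (N : Rel T ℓ)
  (bounded : PosetOps.Bounded Pos) (mlub : PosetOps.MLUBComplete Pos) where
  open Poset Pos using (_≤_) renaming (Carrier to A)
  open TenseOps Pos T N
  open Bounds Pos
  open Pointwise Pos T N bounded mlub

  private
    variable
      p p′ : T → Pred A ℓ

    zero : A
    zero = proj₁ (proj₁ bounded)

    zero-≤ : ∀ x → zero ≤ x
    zero-≤ = proj₂ (proj₁ bounded)

    -- In the opposite poset UpT, MinT and LUDM read LoT, MaxT and UL.
    module Dual = Pointwise (Flip.poset Pos) T N (swap bounded) (λ M M≠∅ → swap (mlub M M≠∅))

  Up-at-LoT : ∀ D t → Up (at (LoT D) t) ≐ Up (Lo (at D t))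
  Up-at-LoT = Dual.LoDM-UpT

  Up-at-MaxT-LoT : ∀ {D} → Satisfiable D → ∀ t → Up (at (MaxT (LoT D)) t) ≐ Up (Lo (at D t))
  Up-at-MaxT-LoT = Dual.LoDM-MinT-UpT

  ⋃future : (T → Pred A ℓ) → T → Pred A ℓ
  ⋃future p s a = ∃[ t ] (N s t × a ∈ p t)

  Ĝ-cong : p ≐T p′ → Ĝ p ≐T Ĝ p′
  Ĝ-cong p≐p′ s = (λ a∈ t sNt → proj₁ (p≐p′ t) (a∈ t sNt))
                , (λ a∈ t sNt → proj₂ (p≐p′ t) (a∈ t sNt))

  Lo-⋃future : ∀ p s → Lo (⋃future p s) ≐ Ĝ (λ t → Lo (p t)) s
  Lo-⋃future p s = (λ a∈ t sNt x x∈ → a∈ x (t , sNt , x∈))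
                 , (λ a∈ x (t , sNt , x∈) → a∈ t sNt x x∈)

  Up-⋃future-mono : (∀ t → Up (p t) ⊆ Up (p′ t)) → ∀ s → Up (⋃future p s) ⊆ Up (⋃future p′ s)
  Up-⋃future-mono Up⊆ s a∈ x (t , sNt , x∈) = Up⊆ t (λ y y∈ → a∈ y (t , sNt , y∈)) x x∈

  Up-⋃future-cong : (∀ t → Up (p t) ≐ Up (p′ t)) → ∀ s → Up (⋃future p s) ≐ Up (⋃future p′ s)
  Up-⋃future-cong Up≐ s = Up-⋃future-mono (proj₁ ∘ Up≐) s , Up-⋃future-mono (proj₂ ∘ Up≐) s

  Gt-MaxĜ : ∀ {B C} → LoDM B ≐T LUDM C → Gt B ≐T MaxP (Ĝ (LUDM C))
  Gt-MaxĜ {B} B≐C s = MaxS-cong (≐-trans (Lo-⋃future (at B) s) (Ĝ-cong B≐C s))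

  G-identities : ∀ {C} → Satisfiable C →
    (MaxP (Ĝ (LUDM C)) ≐T Gt (UpT C)) × (Gt (UpT C) ≐T Gt (MinT (UpT C)))
  G-identities {C} C≠∅ =
      (λ s → ≐-sym (Gt-MaxĜ (LoDM-UpT C) s))
    , (λ s → ≐-trans (Gt-MaxĜ (LoDM-UpT C) s) (≐-sym (Gt-MaxĜ (LoDM-MinT-UpT C≠∅) s)))

  F-identities : (∀ s → ∃[ t ] N s t) → ∀ {D} → Satisfiable D →
    (F̂ (LoDM D) ≐T LoP (Ft (LoT D))) × (LoP (Ft (LoT D)) ≐T LoP (Ft (MaxT (LoT D))))
  F-identities serial {D} D≠∅ =
      (λ s → ≐-sym (≐-trans (Lo-MinS-Up mlub (future-LoT≠∅ s))
                            (Lo-cong (Up-⋃future-cong (Up-at-LoT D) s))))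
    , (λ s → Lo-cong (MinS-cong (Up-⋃future-cong
               (λ t → ≐-trans (Up-at-LoT D t) (≐-sym (Up-at-MaxT-LoT D≠∅ t))) s)))
    where
    future-LoT≠∅ : ∀ s → Satisfiable (future (LoT D) s)
    future-LoT≠∅ s = zero , proj₁ (serial s) , proj₂ (serial s)
                   , (λ _ → zero) , (λ d _ t → zero-≤ (d t)) , refl

theorem4p1 : {ℓ : Level} (Pos : Poset ℓ ℓ ℓ) (T : Set ℓ) (R : Rel T ℓ) →
    let open TenseOps Pos T R in
    Bounded → MLUBComplete → T → Serial R →
    (C D : Pred (T → Poset.Carrier Pos) ℓ) → Satisfiable C → Satisfiable D →
      ((MaxP (Ĝ (LUDM C)) ≐T Gt (UpT C)) × (Gt (UpT C) ≐T Gt (MinT (UpT C))))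
    × ((P̂ (LoDM D) ≐T LoP (Pt (LoT D))) × (LoP (Pt (LoT D)) ≐T LoP (Pt (MaxT (LoT D)))))
    × ((MaxP (Ĥ (LUDM C)) ≐T Ht (UpT C)) × (Ht (UpT C) ≐T Ht (MinT (UpT C))))
    × ((F̂ (LoDM D) ≐T LoP (Ft (LoT D))) × (LoP (Ft (LoT D)) ≐T LoP (Ft (MaxT (LoT D)))))
theorem4p1 Pos T R bounded mlub _ serial C D C≠∅ D≠∅ =
    G-identities C≠∅
  , Past.F-identities (proj₁ ∘ serial) D≠∅
  , Past.G-identities C≠∅
  , F-identities (proj₂ ∘ serial) D≠∅
  where
  open Tense Pos T R bounded mlub
  -- P and H are F and G for the converse relation.
  module Past = Tense Pos T (flip R) bounded mlub
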